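{- For every $\mathbf{S4}$ frame $\mathfrak{F}=\langle W,R\rangle$: $\mathfrak{F}$ satisfies $(su_2)$ if and only if $\mathfrak{F}$ satisfies $(su)$.
   Context: An $\mathbf{S4}$ frame is a set $W$ with a reflexive transitive relation $R$. For $X\subseteq W$: $\mathord{\uparrow}X=\{w:\exists x\in X,\ xRw\}$, $\Diamond X=\{w:\exists x\in X,\ wRx\}$, $\Box X=\{w:\forall v(wRv\Rightarrow v\in X)\}$. For $k\ge1$, $z$ strongly unites $y_0,\dots,y_{k-1}$ if for every $i<k$: $zRy_i$ and $z\in\Box\big(\mathord{\uparrow}\{y_i\}\cup\bigcup_{i'\in k\setminus\{i\}}\Diamond\mathord{\uparrow}\{y_{i'}\}\big)$. $\mathfrak{F}$ satisfies $(su_k)$ if for every $w\in W$ and all $y_0,\dots,y_{k-1}$ with $wRy_i$ for all $i$, there is $z$ with $wRz$ strongly uniting $y_0,\dots,y_{k-1}$. $\mathfrak{F}$ satisfies $(su)$ if it satisfies $(su_k)$ for every $k\ge1$. -}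

module Defs where

open import Level using (Level; _⊔_)
open import Data.Nat using (ℕ; suc)
open import Data.Fin using (Fin)
open import Data.Product using (Σ; ∃; _×_; _,_)
open import Data.Sum using (_⊎_)
open import Relation.Binary.PropositionalEquality using (_≡_)
open import Relation.Nullary using (¬_)
open import Relation.Binary.Definitions using (Reflexive; Transitive)

record S4Frame (a r : Level) : Set (Level.suc (a ⊔ r)) where
  field
    W     : Set a
    R     : W → W → Set r
    refl  : Reflexive R
    trans : Transitive R

module _ {a r : Level} (F : S4Frame a r) where
  open S4Frame F

  Subset : (ℓ : Level) → Set (a ⊔ Level.suc ℓ)
  Subset ℓ = W → Set ℓ

  up : ∀ {ℓ} → Subset ℓ → Subset (a ⊔ r ⊔ ℓ)
  up X w = Σ W (λ x → X x × R x w)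

  dia : ∀ {ℓ} → Subset ℓ → Subset (a ⊔ r ⊔ ℓ)
  dia X w = Σ W (λ x → X x × R w x)

  box : ∀ {ℓ} → Subset ℓ → Subset (a ⊔ r ⊔ ℓ)
  box X w = (v : W) → R w v → X v

  sing : W → Subset a
  sing y x = x ≡ y

  otherDiaUp : {k : ℕ} → (Fin k → W) → Fin k → Subset (a ⊔ r)
  otherDiaUp {k} y i v = Σ (Fin k) (λ i' → ¬ (i' ≡ i) × dia (up (sing (y i'))) v)

  StronglyUnites : {k : ℕ} → W → (Fin k → W) → Set (a ⊔ r)
  StronglyUnites {k} z y =
    (i : Fin k) → R z (y i) × box (λ v → up (sing (y i)) v ⊎ otherDiaUp y i v) z

  -- (su_k), for k ≥ 1 (k is given as suc n)
  SU : ℕ → Set (a ⊔ r)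
  SU n = (w : W) (y : Fin (suc n) → W) → ((i : Fin (suc n)) → R w (y i)) →
         Σ W (λ z → R w z × StronglyUnites z y)

  SU₂ : Set (a ⊔ r)
  SU₂ = SU 1

  SUall : Set (a ⊔ r)
  SUall = (n : ℕ) → SU n

{-# OPTIONS --safe #-}
-- Induction on k, with (su_1) trivial (y₀ unites itself). To unite y₀, …, yₖ
-- first unite the tail y₁, …, yₖ by some z', then unite the pair z', y₀ by z.
-- Every point above z' lies in ◇↑{yⱼ} for some j ≥ 1, and ◇↑{yⱼ} is closed
-- downwards, so the ◇↑{z'} part of z's cover becomes part of the cover
-- required for y₀; for the other yᵢ, points above z that are not in ◇↑{y₀}
-- lie above z', where the cover given by z' applies.
module Submission where

open import Defs
open import Level using (Level; _⊔_)
open import Function using (_∘_)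
open import Function.Bundles using (_⇔_; mk⇔)
open import Data.Nat using (ℕ; zero; suc)
open import Data.Fin using (Fin; zero; suc)
open import Data.Fin.Properties using (suc-injective)
open import Data.Vec.Functional using ([]; _∷_; head; tail)
open import Data.Product using (Σ; _×_; _,_; proj₁; proj₂)
open import Data.Sum using (_⊎_; inj₁; inj₂)
open import Data.Empty using (⊥-elim)
open import Relation.Binary.PropositionalEquality using (refl)

module _ {a r : Level} (F : S4Frame a r) where
  open S4Frame F hiding (refl)
  open S4Frame F using () renaming (refl to R-refl)

  Cover : {k : ℕ} → (Fin k → W) → Fin k → W → Set (a ⊔ r)
  Cover y i v = up F (sing F (y i)) v ⊎ otherDiaUp F y i v

  dia-downward-closed : ∀ {ℓ} {X : Subset F ℓ} {v x : W} → R v x → dia F X x → dia F X v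
  dia-downward-closed vx (x' , x'∈X , xx') = x' , x'∈X , trans vx xx'

  stronglyUnites⇒◇↑-some : ∀ {n} {z x : W} {y : Fin (suc n) → W} →
    StronglyUnites F z y → R z x → Σ (Fin (suc n)) λ j → dia F (up F (sing F (y j))) x
  stronglyUnites⇒◇↑-some {x = x} U zx with proj₂ (U zero) x zx
  ... | inj₁ x∈↑y₀            = zero , x , x∈↑y₀ , R-refl
  ... | inj₂ (j , _ , x∈◇↑yⱼ) = j , x∈◇↑yⱼ

  module _ {n : ℕ} {z z' : W} {y : Fin (suc (suc n)) → W}
           (U' : StronglyUnites F z' (tail y))
           (U : StronglyUnites F z (z' ∷ head y ∷ [])) where

    unites-head : R z (head y) × box F (Cover y zero) z
    unites-head = proj₁ (U (suc zero)) , cover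
      where
      cover : box F (Cover y zero) z
      cover v zv with proj₂ (U (suc zero)) v zv
      ... | inj₁ v∈↑y₀ = inj₁ v∈↑y₀
      ... | inj₂ (zero , _ , (x , (_ , refl , z'x) , vx)) =
        let j , x∈◇↑yⱼ = stronglyUnites⇒◇↑-some U' z'x
        in inj₂ (suc j , (λ ()) , dia-downward-closed vx x∈◇↑yⱼ)
      ... | inj₂ (suc zero , 1≢1 , _) = ⊥-elim (1≢1 refl)

    unites-tail : (i : Fin (suc n)) → R z (y (suc i)) × box F (Cover y (suc i)) z
    unites-tail i = trans (proj₁ (U zero)) (proj₁ (U' i)) , cover
      where
      shift : ∀ {v} → Cover (tail y) i v → Cover y (suc i) v
      shift (inj₁ v∈↑yᵢ)           = inj₁ v∈↑yᵢ
      shift (inj₂ (j , j≢i , v∈◇↑)) = inj₂ (suc j , j≢i ∘ suc-injective , v∈◇↑)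

      cover : box F (Cover y (suc i)) z
      cover v zv with proj₂ (U zero) v zv
      ... | inj₁ (_ , refl , z'v)        = shift (proj₂ (U' i) v z'v)
      ... | inj₂ (zero , 0≢0 , _)        = ⊥-elim (0≢0 refl)
      ... | inj₂ (suc zero , _ , v∈◇↑y₀) = inj₂ (zero , (λ ()) , v∈◇↑y₀)

    stronglyUnites-cons : StronglyUnites F z y
    stronglyUnites-cons zero    = unites-head
    stronglyUnites-cons (suc i) = unites-tail i

  SU-zero : SU F 0
  SU-zero w y wy = head y , wy zero , λ { zero → R-refl , λ v yv → inj₁ (head y , refl , yv) }

  SU₂⇒SU-suc : ∀ {n} → SU₂ F → SU F n → SU F (suc n)
  SU₂⇒SU-suc su₂ suₙ w y wy with suₙ w (tail y) (wy ∘ suc)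
  ... | z' , wz' , U' with su₂ w (z' ∷ head y ∷ []) (λ { zero → wz' ; (suc zero) → wy zero })
  ... | z , wz , U = z , wz , stronglyUnites-cons U' U

  SU₂⇒SUall : SU₂ F → SUall F
  SU₂⇒SUall su₂ zero    = SU-zero
  SU₂⇒SUall su₂ (suc n) = SU₂⇒SU-suc su₂ (SU₂⇒SUall su₂ n)

corollary1 : {a r : Level} (F : S4Frame a r) → SU₂ F ⇔ SUall F
corollary1 F = mk⇔ (SU₂⇒SUall F) (λ su → su 1)
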